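{- If $(\alpha_n,\beta_n)_{n\ge0}$ is a Bailey pair relative to $a$, then so is $(\alpha'_n,\beta'_n)_{n\ge0}$, where \[ \alpha'_n=a^nq^{n^2-n}\Big((1+q^{2n})\alpha_n+(1-aq^{2n})(1-a^{ -1})\sum_{\ell=0}^{n-1}\alpha_\ell\Big),\qquad \beta'_n=\sum_{\ell=0}^{n}\frac{a^\ell q^{\ell^2}}{(q)_{n-\ell}}(q^n+q^{ -\ell})\beta_\ell. \]
   Context: Fix complex numbers $a$ and $q$ (with the relevant denominators nonzero). $(x)_n=(x;q)_n=\prod_{m=0}^{n-1}(1-xq^m)$. A Bailey pair relative to $a$ is a pair of sequences $((\alpha_n)_{n\ge0},(\beta_n)_{n\ge0})$ such that $\beta_n=\sum_{\ell=0}^n\frac{\alpha_\ell}{(q)_{n-\ell}(aq)_{n+\ell}}$ for all $n\ge0$; by convention $\alpha_\ell=0$ for $\ell<0$. -}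

module Defs where

open import Level using (Level)
open import Data.Nat using (ℕ; zero; suc; _∸_) renaming (_+_ to _+ℕ_; _*_ to _*ℕ_)
open import Algebra.Bundles using (CommutativeRing)

-- Everything is stated over an arbitrary commutative ring R (in the paper R = ℂ).
module QSeries {c ℓ : Level} (R : CommutativeRing c ℓ) where
  open CommutativeRing R

  pow : Carrier → ℕ → Carrier
  pow x zero = 1#
  pow x (suc n) = x * pow x n

  poch : Carrier → Carrier → ℕ → Carrier
  poch x q zero = 1#
  poch x q (suc n) = poch x q n * (1# - x * pow q n)

  sumTo : ℕ → (ℕ → Carrier) → Carrier
  sumTo zero f = 0#
  sumTo (suc n) f = sumTo n f + f n

  IsInverse : Carrier → Carrier → Set ℓ
  IsInverse x y = x * y ≈ 1#

  -- Bailey pair relative to a.  Division by (q)_k and (aq)_k is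
  -- multiplication by the given inverses iq k = (q;q)_k⁻¹ and iaq k = (aq;q)_k⁻¹.
  -- β_n = Σ_{ℓ=0}^{n} α_ℓ / ((q)_{n-ℓ} (aq)_{n+ℓ})
  BaileyPair : (iq iaq : ℕ → Carrier) → (α β : ℕ → Carrier) → Set ℓ
  BaileyPair iq iaq α β =
    ∀ n → β n ≈ sumTo (suc n) (λ l → α l * (iq (n ∸ l) * iaq (n +ℕ l)))

  alpha' : (a q ia : Carrier) → (α : ℕ → Carrier) → ℕ → Carrier
  alpha' a q ia α n =
    pow a n * pow q (n *ℕ n ∸ n) *
      ((1# + pow q (2 *ℕ n)) * α n
        + (1# - a * pow q (2 *ℕ n)) * (1# - ia) * sumTo n α)

  beta' : (a q iqq : Carrier) → (iq : ℕ → Carrier) → (β : ℕ → Carrier) → ℕ → Carrier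
  beta' a q iqq iq β n =
    sumTo (suc n) (λ l →
      pow a l * pow q (l *ℕ l) * iq (n ∸ l) * (pow q n + pow iqq l) * β l)

module Submission where

-- Inserting the Bailey pair into β'_n and exchanging the order of summation gives
-- β'_n = Σ_{j+s=n} α_j L_j(s), where L_j(s) is a combination of the two sums
-- Σ_{i+r=s} (a q^m)^i q^{i²} q^{-εi} / ((q)_r (q)_i (aq)_{m+i}),  m = 2j, ε ∈ {0, 1}.
-- By the q-Pascal rule the sum with ε = 0 satisfies a recursion in s solved by the
-- q-Chu–Vandermonde value 1 / ((q)_s (aq)_{m+s}); the sum with ε = 1 is obtained from it by
-- splitting 1/(q)_r = 1/(q)_{r-1} + q^r/(q)_r.  On the other side, the partial sums
-- Σ_{ℓ<l} α_ℓ in α'_l contribute to the coefficient of α_j a sum over l > j which telescopes.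
-- Both coefficients of α_j come out as
-- a^j q^{j²-j} ((1 + q^{2j}) + (a - 1) q^{2j} (1 - q^s)) / ((q)_s (aq)_{2j+s}).

open import Defs
open import Level using (Level)
open import Algebra.Bundles using (CommutativeRing)
open import Data.Nat as ℕ using (ℕ; zero; suc; _∸_)
open import Data.Integer as ℤ using (ℤ; +_; -[1+_]; _⊖_)
import Data.Integer.Properties as ℤ
import Data.Nat.Properties as ℕ
open import Data.Maybe using (Maybe; just; nothing)
open import Relation.Nullary using (yes; no)
open import Relation.Binary.PropositionalEquality as ≡ using (_≡_)
open import Algebra.Solver.Ring.AlmostCommutativeRing
  using (fromCommutativeRing; _-Raw-AlmostCommutative⟶_)
import Algebra.Solver.Ring as RingSolver
import Algebra.Properties.Ring as RingProperties
open import Data.Nat.Tactic.RingSolver using (solve-∀)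

-- The ring solver needs a coefficient ring with decidable equality; for an
-- arbitrary commutative ring that is ℤ, through its canonical homomorphism.
module ℤ-CoefficientSolver {c ℓ : Level} (R : CommutativeRing c ℓ) where
  open CommutativeRing R
  open import Algebra.Properties.Semiring.Mult.TCOptimised semiring
    using (_×_; ×-homo-+; ×1-homo-*; 1+×)
  open RingProperties ring
    using (-‿involutive; -0#≈0#; -‿distribˡ-*; -‿distribʳ-*; -‿+-comm)
  open import Relation.Binary.Reasoning.Setoid setoid

  fromℤ : ℤ → Carrier
  fromℤ (+ n) = n × 1#
  fromℤ -[1+ n ] = - (suc n × 1#)

  fromℤ-homo-neg : ∀ i → fromℤ (ℤ.- i) ≈ - fromℤ i
  fromℤ-homo-neg (+ zero) = sym -0#≈0#
  fromℤ-homo-neg (+ suc n) = refl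
  fromℤ-homo-neg -[1+ n ] = sym (-‿involutive _)

  fromℤ-homo-⊖ : ∀ m n → fromℤ (m ⊖ n) ≈ m × 1# - n × 1#
  fromℤ-homo-⊖ m zero = begin
    m × 1#       ≈⟨ sym (+-identityʳ _) ⟩
    m × 1# + 0#  ≈⟨ +-congˡ (sym -0#≈0#) ⟩
    m × 1# - 0#  ∎
  fromℤ-homo-⊖ zero (suc n) = sym (+-identityˡ _)
  fromℤ-homo-⊖ (suc m) (suc n) = begin
    fromℤ (suc m ⊖ suc n)              ≈⟨ reflexive (≡.cong fromℤ (ℤ.[1+m]⊖[1+n]≡m⊖n m n)) ⟩
    fromℤ (m ⊖ n)                      ≈⟨ fromℤ-homo-⊖ m n ⟩
    m × 1# - n × 1#                ≈⟨ -‿cancel-1+ _ _ ⟩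
    (1# + m × 1#) - (1# + n × 1#)  ≈⟨ sym (+-cong (1+× m 1#) (-‿cong (1+× n 1#))) ⟩
    suc m × 1# - suc n × 1#        ∎
    where
    -‿cancel-1+ : ∀ x y → x - y ≈ (1# + x) - (1# + y)
    -‿cancel-1+ x y = begin
      x - y                  ≈⟨ sym (+-identityˡ _) ⟩
      0# + (x - y)           ≈⟨ +-congʳ (sym (-‿inverseʳ 1#)) ⟩
      (1# - 1#) + (x - y)    ≈⟨ +-assoc _ _ _ ⟩
      1# + (- 1# + (x - y))  ≈⟨ +-congˡ (sym (+-assoc _ _ _)) ⟩
      1# + ((- 1# + x) - y)  ≈⟨ +-congˡ (+-congʳ (+-comm _ _)) ⟩
      1# + ((x - 1#) - y)    ≈⟨ +-congˡ (+-assoc _ _ _) ⟩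
      1# + (x + (- 1# - y))  ≈⟨ +-congˡ (+-congˡ (-‿+-comm _ _)) ⟩
      1# + (x - (1# + y))    ≈⟨ sym (+-assoc _ _ _) ⟩
      (1# + x) - (1# + y)    ∎

  fromℤ-homo-+ : ∀ i j → fromℤ (i ℤ.+ j) ≈ fromℤ i + fromℤ j
  fromℤ-homo-+ (+ m) (+ n) = ×-homo-+ 1# m n
  fromℤ-homo-+ (+ m) -[1+ n ] = fromℤ-homo-⊖ m (suc n)
  fromℤ-homo-+ -[1+ m ] (+ n) = trans (fromℤ-homo-⊖ n (suc m)) (+-comm _ _)
  fromℤ-homo-+ -[1+ m ] -[1+ n ] = begin
    - (suc (suc (m ℕ.+ n)) × 1#)  ≈⟨ -‿cong (reflexive (≡.cong (_× 1#) (≡.sym (ℕ.+-suc (suc m) n)))) ⟩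
    - ((suc m ℕ.+ suc n) × 1#)    ≈⟨ -‿cong (×-homo-+ 1# (suc m) (suc n)) ⟩
    - (suc m × 1# + suc n × 1#)   ≈⟨ sym (-‿+-comm _ _) ⟩
    - (suc m × 1#) - suc n × 1#   ∎

  fromℤ-homo-*-pos : ∀ m n → fromℤ (+ m ℤ.* + n) ≈ fromℤ (+ m) * fromℤ (+ n)
  fromℤ-homo-*-pos m n = trans (reflexive (≡.cong fromℤ (≡.sym (ℤ.pos-* m n)))) (×1-homo-* m n)

  fromℤ-homo-* : ∀ i j → fromℤ (i ℤ.* j) ≈ fromℤ i * fromℤ j
  fromℤ-homo-* (+ m) (+ n) = fromℤ-homo-*-pos m n
  fromℤ-homo-* (+ m) -[1+ n ] = begin
    fromℤ (+ m ℤ.* ℤ.- (+ suc n))  ≈⟨ reflexive (≡.cong fromℤ (≡.sym (ℤ.neg-distribʳ-* (+ m) (+ suc n)))) ⟩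
    fromℤ (ℤ.- (+ m ℤ.* + suc n))  ≈⟨ fromℤ-homo-neg (+ m ℤ.* + suc n) ⟩
    - fromℤ (+ m ℤ.* + suc n)      ≈⟨ -‿cong (fromℤ-homo-*-pos m (suc n)) ⟩
    - (m × 1# * suc n × 1#)    ≈⟨ -‿distribʳ-* _ _ ⟩
    m × 1# * - (suc n × 1#)    ∎
  fromℤ-homo-* -[1+ m ] (+ n) = begin
    fromℤ (ℤ.- (+ suc m) ℤ.* + n)  ≈⟨ reflexive (≡.cong fromℤ (≡.sym (ℤ.neg-distribˡ-* (+ suc m) (+ n)))) ⟩
    fromℤ (ℤ.- (+ suc m ℤ.* + n))  ≈⟨ fromℤ-homo-neg (+ suc m ℤ.* + n) ⟩
    - fromℤ (+ suc m ℤ.* + n)      ≈⟨ -‿cong (fromℤ-homo-*-pos (suc m) n) ⟩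
    - (suc m × 1# * n × 1#)    ≈⟨ -‿distribˡ-* _ _ ⟩
    - (suc m × 1#) * n × 1#    ∎
  fromℤ-homo-* -[1+ m ] -[1+ n ] = begin
    fromℤ (+ suc m ℤ.* + suc n)            ≈⟨ fromℤ-homo-*-pos (suc m) (suc n) ⟩
    suc m × 1# * suc n × 1#            ≈⟨ sym (-‿involutive _) ⟩
    - - (suc m × 1# * suc n × 1#)      ≈⟨ -‿cong (-‿distribˡ-* _ _) ⟩
    - (- (suc m × 1#) * suc n × 1#)    ≈⟨ -‿distribʳ-* _ _ ⟩
    - (suc m × 1#) * - (suc n × 1#)    ∎

  ℤ⟶R : CommutativeRing.rawRing ℤ.+-*-commutativeRing
          -Raw-AlmostCommutative⟶ fromCommutativeRing R
  ℤ⟶R = record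
    { ⟦_⟧ = fromℤ
    ; +-homo = fromℤ-homo-+
    ; *-homo = fromℤ-homo-*
    ; -‿homo = fromℤ-homo-neg
    ; 0-homo = refl
    ; 1-homo = refl
    }

  fromℤ-≟ : ∀ i j → Maybe (fromℤ i ≈ fromℤ j)
  fromℤ-≟ i j with i ℤ.≟ j
  ... | yes ≡.refl = just refl
  ... | no _ = nothing

  open RingSolver _ (fromCommutativeRing R) ℤ⟶R fromℤ-≟ public

  one : ∀ {n} → Polynomial n
  one = con (+ 1)

module PowProperties {c ℓ : Level} (R : CommutativeRing c ℓ) where
  open CommutativeRing R
  open QSeries R
  open import Algebra.Properties.CommutativeSemiring.Exp commutativeSemiring
    using (_^_; ^-homo-*; ^-assocʳ; ^-distrib-*; ^-congˡ)
  open import Algebra.Properties.CommutativeSemigroup *-commutativeSemigroup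
    using (interchange)
  open import Relation.Binary.Reasoning.Setoid setoid

  pow≡^ : ∀ x n → pow x n ≡ x ^ n
  pow≡^ x zero = ≡.refl
  pow≡^ x (suc n) = ≡.cong (x *_) (pow≡^ x n)

  pow-cong : ∀ n {x y} → x ≈ y → pow x n ≈ pow y n
  pow-cong n {x} {y} x≈y rewrite pow≡^ x n | pow≡^ y n = ^-congˡ n x≈y

  pow-+ : ∀ x m n → pow x (m ℕ.+ n) ≈ pow x m * pow x n
  pow-+ x m n rewrite pow≡^ x (m ℕ.+ n) | pow≡^ x m | pow≡^ x n = ^-homo-* x m n

  pow-* : ∀ x y n → pow (x * y) n ≈ pow x n * pow y n
  pow-* x y n rewrite pow≡^ (x * y) n | pow≡^ x n | pow≡^ y n = ^-distrib-* x y n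

  pow-pow : ∀ x m n → pow (pow x m) n ≈ pow x (m ℕ.* n)
  pow-pow x m n rewrite pow≡^ (pow x m) n | pow≡^ x m | pow≡^ x (m ℕ.* n) = ^-assocʳ x m n

  pow-square-suc : ∀ x n → pow x (suc n ℕ.* suc n) ≈ x * (pow x n * (pow x n * pow x (n ℕ.* n)))
  pow-square-suc x n = *-congˡ (begin
    pow x (n ℕ.+ n ℕ.* suc n)                ≈⟨ reflexive (≡.cong (λ k → pow x (n ℕ.+ k)) (ℕ.*-suc n n)) ⟩
    pow x (n ℕ.+ (n ℕ.+ n ℕ.* n))            ≈⟨ pow-+ x n _ ⟩
    pow x n * pow x (n ℕ.+ n ℕ.* n)          ≈⟨ *-congˡ (pow-+ x n (n ℕ.* n)) ⟩
    pow x n * (pow x n * pow x (n ℕ.* n))    ∎)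

  pow-double : ∀ x n → pow x (2 ℕ.* n) ≈ pow x n * pow x n
  pow-double x n = trans (pow-+ x n (n ℕ.+ 0)) (*-congˡ (reflexive (≡.cong (pow x) (ℕ.+-identityʳ n))))

  pow-square-split : ∀ x n → pow x (n ℕ.* n) ≈ pow x (n ℕ.* n ∸ n) * pow x n
  pow-square-split x zero = sym (*-identityˡ 1#)
  pow-square-split x (suc n) = trans (reflexive (≡.cong (pow x) (≡.sym (ℕ.m∸n+n≡m (ℕ.m≤m*n (suc n) (suc n))))))
                                     (pow-+ x (suc n ℕ.* suc n ∸ suc n) (suc n))

  pow-square∸-suc : ∀ x n → pow x (suc n ℕ.* suc n ∸ suc n) ≈ pow x n * pow x (n ℕ.* n)
  pow-square∸-suc x n =
    trans (reflexive (≡.cong (pow x) (≡.trans (ℕ.m+n∸m≡n (suc n) (n ℕ.* suc n)) (ℕ.*-suc n n))))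
          (pow-+ x n (n ℕ.* n))

  pow-inverse : ∀ {x y} → IsInverse x y → ∀ n → IsInverse (pow x n) (pow y n)
  pow-inverse xy≈1 zero = *-identityˡ 1#
  pow-inverse {x} {y} xy≈1 (suc n) =
    trans (interchange x _ y _) (trans (*-cong xy≈1 (pow-inverse xy≈1 n)) (*-identityˡ 1#))

module AntidiagonalSums {c ℓ : Level} (R : CommutativeRing c ℓ) where
  open CommutativeRing R
  open QSeries R
  open import Relation.Binary.Reasoning.Setoid setoid
  open import Algebra.Properties.CommutativeSemigroup +-commutativeSemigroup
    using (interchange)

  antidiagonalSum : ℕ → (ℕ → ℕ → Carrier) → Carrier
  antidiagonalSum zero f = f 0 0
  antidiagonalSum (suc n) f = f 0 (suc n) + antidiagonalSum n (λ i j → f (suc i) j)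

  antidiagonalSum-cong : ∀ n {f g : ℕ → ℕ → Carrier} →
    (∀ i j → i ℕ.+ j ≡ n → f i j ≈ g i j) → antidiagonalSum n f ≈ antidiagonalSum n g
  antidiagonalSum-cong zero f≈g = f≈g 0 0 ≡.refl
  antidiagonalSum-cong (suc n) f≈g =
    +-cong (f≈g 0 (suc n) ≡.refl) (antidiagonalSum-cong n (λ i j eq → f≈g (suc i) j (≡.cong suc eq)))

  antidiagonalSum-distrib-+ : ∀ n (f g : ℕ → ℕ → Carrier) →
    antidiagonalSum n (λ i j → f i j + g i j) ≈ antidiagonalSum n f + antidiagonalSum n g
  antidiagonalSum-distrib-+ zero f g = refl
  antidiagonalSum-distrib-+ (suc n) f g =
    trans (+-congˡ (antidiagonalSum-distrib-+ n _ _)) (interchange _ _ _ _)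

  *-distribˡ-antidiagonalSum : ∀ n x (f : ℕ → ℕ → Carrier) →
    x * antidiagonalSum n f ≈ antidiagonalSum n (λ i j → x * f i j)
  *-distribˡ-antidiagonalSum zero x f = refl
  *-distribˡ-antidiagonalSum (suc n) x f =
    trans (distribˡ _ _ _) (+-congˡ (*-distribˡ-antidiagonalSum n x _))

  antidiagonalSum-last : ∀ n (f : ℕ → ℕ → Carrier) →
    antidiagonalSum (suc n) f ≈ antidiagonalSum n (λ i j → f i (suc j)) + f (suc n) 0
  antidiagonalSum-last zero f = refl
  antidiagonalSum-last (suc n) f =
    trans (+-congˡ (antidiagonalSum-last n (λ i j → f (suc i) j))) (sym (+-assoc _ _ _))

  antidiagonalSum-dropFirst : ∀ n (f : ℕ → ℕ → Carrier) → f 0 (suc n) ≈ 0# →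
    antidiagonalSum (suc n) f ≈ antidiagonalSum n (λ i j → f (suc i) j)
  antidiagonalSum-dropFirst n f f≈0 = trans (+-congʳ f≈0) (+-identityˡ _)

  antidiagonalSum-dropLast : ∀ n (f : ℕ → ℕ → Carrier) → f (suc n) 0 ≈ 0# →
    antidiagonalSum (suc n) f ≈ antidiagonalSum n (λ i j → f i (suc j))
  antidiagonalSum-dropLast n f f≈0 =
    trans (antidiagonalSum-last n f) (trans (+-congˡ f≈0) (+-identityʳ _))

  antidiagonalSum-assoc : ∀ n (F : ℕ → ℕ → ℕ → Carrier) →
    antidiagonalSum n (λ l r → antidiagonalSum l (λ j i → F j i r)) ≈
    antidiagonalSum n (λ j s → antidiagonalSum s (λ i r → F j i r))
  antidiagonalSum-assoc zero F = refl
  antidiagonalSum-assoc (suc n) F = begin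
    F 0 0 (suc n) + antidiagonalSum n (λ l r → F 0 (suc l) r + inner l r)
      ≈⟨ +-congˡ (antidiagonalSum-distrib-+ n _ _) ⟩
    F 0 0 (suc n) + (antidiagonalSum n (λ l r → F 0 (suc l) r) + antidiagonalSum n inner)
      ≈⟨ +-congˡ (+-congˡ (antidiagonalSum-assoc n (λ j → F (suc j)))) ⟩
    F 0 0 (suc n) + (antidiagonalSum n (λ l r → F 0 (suc l) r) +
                     antidiagonalSum n (λ j s → antidiagonalSum s (λ i r → F (suc j) i r)))
      ≈⟨ sym (+-assoc _ _ _) ⟩
    (F 0 0 (suc n) + antidiagonalSum n (λ l r → F 0 (suc l) r)) +
      antidiagonalSum n (λ j s → antidiagonalSum s (λ i r → F (suc j) i r)) ∎
    where
    inner : ℕ → ℕ → Carrier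
    inner l r = antidiagonalSum l (λ j i → F (suc j) i r)

  sumTo-head : ∀ n (f : ℕ → Carrier) → sumTo (suc n) f ≈ f 0 + sumTo n (λ l → f (suc l))
  sumTo-head zero f = +-comm _ _
  sumTo-head (suc n) f = trans (+-congʳ (sumTo-head n f)) (+-assoc _ _ _)

  sumTo-antidiagonalSum : ∀ n (G : ℕ → ℕ → Carrier) →
    sumTo (suc n) (G n) ≈ antidiagonalSum n (λ l r → G (l ℕ.+ r) l)
  sumTo-antidiagonalSum zero G = +-identityˡ _
  sumTo-antidiagonalSum (suc n) G =
    trans (sumTo-head (suc n) _) (+-congˡ (sumTo-antidiagonalSum n (λ m l → G (suc m) (suc l))))

module InverseProperties {c ℓ : Level} (R : CommutativeRing c ℓ) where
  open CommutativeRing R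
  open QSeries R
  open ℤ-CoefficientSolver R using (solve; _:=_; _:+_; _:*_; _:-_; one)
  open import Relation.Binary.Reasoning.Setoid setoid

  x≈1⇒y+[x-1]z≈y : ∀ {x} y z → x ≈ 1# → y + (x - 1#) * z ≈ y
  x≈1⇒y+[x-1]z≈y {x} y z x≈1 = begin
    y + (x - 1#) * z   ≈⟨ +-congˡ (*-congʳ (+-congʳ x≈1)) ⟩
    y + (1# - 1#) * z  ≈⟨ solve 2 (λ y z → y :+ (one :- one) :* z := y) refl y z ⟩
    y                  ∎

  invertible-*-cancelˡ : ∀ {x y u v} → IsInverse x y → x * u ≈ x * v → u ≈ v
  invertible-*-cancelˡ {x} {y} {u} {v} xy≈1 xu≈xv = begin
    u            ≈⟨ sym (*-identityˡ u) ⟩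
    1# * u       ≈⟨ *-congʳ (sym (trans (*-comm y x) xy≈1)) ⟩
    y * x * u    ≈⟨ *-assoc y x u ⟩
    y * (x * u)  ≈⟨ *-congˡ xu≈xv ⟩
    y * (x * v)  ≈⟨ sym (*-assoc y x v) ⟩
    y * x * v    ≈⟨ *-congʳ (trans (*-comm y x) xy≈1) ⟩
    1# * v       ≈⟨ *-identityˡ v ⟩
    v            ∎

  module InversePochhammer {x q : Carrier} {i : ℕ → Carrier}
                           (inverse : ∀ k → IsInverse (poch x q k) (i k)) where

    inverse-poch-zero : i 0 ≈ 1#
    inverse-poch-zero = trans (sym (*-identityˡ _)) (inverse 0)

    inverse-poch-suc : ∀ k → i (suc k) * (1# - x * pow q k) ≈ i k
    inverse-poch-suc k = begin
      i (suc k) * u                             ≈⟨ sym (*-identityʳ _) ⟩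
      i (suc k) * u * 1#                        ≈⟨ *-congˡ (sym (inverse k)) ⟩
      i (suc k) * u * (poch x q k * i k)        ≈⟨ solve 4 (λ i' u p i → i' :* u :* (p :* i) := p :* u :* i' :* i)
                                                          refl (i (suc k)) u (poch x q k) (i k) ⟩
      poch x q (suc k) * i (suc k) * i k        ≈⟨ *-congʳ (inverse (suc k)) ⟩
      1# * i k                                  ≈⟨ *-identityˡ _ ⟩
      i k                                       ∎
      where
      u : Carrier
      u = 1# - x * pow q k

module QSeriesIdentities {c ℓ : Level} (R : CommutativeRing c ℓ) where
  open CommutativeRing R
  open QSeries R
  open PowProperties R
  open AntidiagonalSums R
  open InverseProperties R
  open ℤ-CoefficientSolver R using (solve; _:=_; _:+_; _:*_; _:-_; con; one)
  open import Algebra.Properties.CommutativeSemigroup *-commutativeSemigroup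
    using (x∙yz≈y∙xz; xy∙z≈y∙xz)
  open import Relation.Binary.Reasoning.Setoid setoid

  module QPascal (q : Carrier) (iq : ℕ → Carrier)
                 (iq-inverse : ∀ k → IsInverse (poch q q k) (iq k)) where
    open InversePochhammer iq-inverse public
      renaming (inverse-poch-zero to iq-zero; inverse-poch-suc to iq-suc)

    -- 1 / (q)_{r-1}, with the convention 1 / (q)_{-1} = 0
    iq-pred : ℕ → Carrier
    iq-pred zero = 0#
    iq-pred (suc r) = iq r

    iq-pred≈ : ∀ r → iq-pred r ≈ (1# - pow q r) * iq r
    iq-pred≈ zero = solve 1 (λ x → con (+ 0) := (one :- one) :* x) refl (iq 0)
    iq-pred≈ (suc r) = sym (trans (*-comm _ _) (iq-suc r))

    iq-split : ∀ r → iq r ≈ iq-pred r + pow q r * iq r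
    iq-split r = begin
      iq r                                    ≈⟨ solve 2 (λ Q x → x := (one :- Q) :* x :+ Q :* x) refl (pow q r) (iq r) ⟩
      (1# - pow q r) * iq r + pow q r * iq r  ≈⟨ +-congʳ (sym (iq-pred≈ r)) ⟩
      iq-pred r + pow q r * iq r              ∎

    q-pascal : ∀ i r → (1# - pow q (i ℕ.+ r)) * (iq r * iq i) ≈
                       iq-pred r * iq i + pow q r * (iq r * iq-pred i)
    q-pascal i r = begin
      (1# - pow q (i ℕ.+ r)) * (iq r * iq i)
        ≈⟨ *-congʳ (+-congˡ (-‿cong (pow-+ q i r))) ⟩
      (1# - pow q i * pow q r) * (iq r * iq i)
        ≈⟨ solve 4 (λ Qi Qr x y → (one :- Qi :* Qr) :* (x :* y) :=
                                  (one :- Qr) :* x :* y :+ Qr :* (x :* ((one :- Qi) :* y)))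
                   refl (pow q i) (pow q r) (iq r) (iq i) ⟩
      (1# - pow q r) * iq r * iq i + pow q r * (iq r * ((1# - pow q i) * iq i))
        ≈⟨ sym (+-cong (*-congʳ (iq-pred≈ r)) (*-congˡ (*-congˡ (iq-pred≈ i)))) ⟩
      iq-pred r * iq i + pow q r * (iq r * iq-pred i) ∎

  module ChuVandermonde (a q : Carrier)
    (iq : ℕ → Carrier) (iq-inverse : ∀ k → IsInverse (poch q q k) (iq k))
    (iaq : ℕ → Carrier) (iaq-inverse : ∀ k → IsInverse (poch (a * q) q k) (iaq k)) where
    open QPascal q iq iq-inverse public
    open InversePochhammer iaq-inverse using () renaming (inverse-poch-suc to iaq-suc)

    weight : ℕ → ℕ → Carrier
    weight m i = pow (a * pow q m) i * pow q (i ℕ.* i) * iaq (m ℕ.+ i)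

    kernel : ℕ → ℕ → Carrier
    kernel m s = antidiagonalSum s (λ i r → iq r * iq i * weight m i)

    weight-shift : ∀ m s i r → i ℕ.+ r ≡ s →
      pow q r * weight m (suc i) ≈ a * pow q (suc m) * pow q s * weight (suc m) i
    weight-shift m s i r i+r≡s = begin
      pow q r * (a * Qm * B * pow q (suc i ℕ.* suc i) * iaq (m ℕ.+ suc i))
        ≈⟨ *-congˡ (*-cong (*-congˡ (pow-square-suc q i)) (reflexive (≡.cong iaq (ℕ.+-suc m i)))) ⟩
      pow q r * (a * Qm * B * (q * (Qi * (Qi * Qii))) * A)
        ≈⟨ solve 8 (λ a Qm B q Qi Qii A Qr →
                      Qr :* (a :* Qm :* B :* (q :* (Qi :* (Qi :* Qii))) :* A) :=
                      a :* (q :* Qm) :* (Qi :* Qr) :* (B :* Qi :* Qii :* A))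
                   refl a Qm B q Qi Qii A (pow q r) ⟩
      a * (q * Qm) * (Qi * pow q r) * (B * Qi * Qii * A)
        ≈⟨ *-cong (*-congˡ (trans (sym (pow-+ q i r)) (reflexive (≡.cong (pow q) i+r≡s))))
                  (*-congʳ (*-congʳ (sym B′≈BQi))) ⟩
      a * pow q (suc m) * pow q s * weight (suc m) i ∎
      where
      Qm = pow q m
      Qi = pow q i
      Qii = pow q (i ℕ.* i)
      B = pow (a * Qm) i
      A = iaq (suc m ℕ.+ i)
      B′≈BQi : pow (a * (q * Qm)) i ≈ B * Qi
      B′≈BQi = trans (pow-cong i (solve 3 (λ a q Qm → a :* (q :* Qm) := a :* Qm :* q) refl a q Qm))
                     (pow-* (a * Qm) q i)

    kernel-step : ∀ m s → (1# - pow q (suc s)) * kernel m (suc s) ≈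
                          kernel m s + a * pow q (suc m) * pow q s * kernel (suc m) s
    kernel-step m s = begin
      (1# - pow q (suc s)) * kernel m (suc s)
        ≈⟨ *-distribˡ-antidiagonalSum (suc s) _ (λ i r → iq r * iq i * weight m i) ⟩
      antidiagonalSum (suc s) (λ i r → (1# - pow q (suc s)) * (iq r * iq i * weight m i))
        ≈⟨ antidiagonalSum-cong (suc s) pascal ⟩
      antidiagonalSum (suc s) (λ i r → iq-pred r * iq i * weight m i +
                                       pow q r * (iq r * iq-pred i) * weight m i)
        ≈⟨ antidiagonalSum-distrib-+ (suc s) first second ⟩
      antidiagonalSum (suc s) first + antidiagonalSum (suc s) second
        ≈⟨ +-cong (antidiagonalSum-dropLast s first (trans (*-congʳ (zeroˡ _)) (zeroˡ _)))
                  (antidiagonalSum-dropFirst s second (trans (*-congʳ (trans (*-congˡ (zeroʳ _)) (zeroʳ _))) (zeroˡ _))) ⟩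
      kernel m s + antidiagonalSum s (λ i r → pow q r * (iq r * iq i) * weight m (suc i))
        ≈⟨ +-congˡ (antidiagonalSum-cong s shift) ⟩
      kernel m s + antidiagonalSum s (λ i r → X * (iq r * iq i * weight (suc m) i))
        ≈⟨ +-congˡ (sym (*-distribˡ-antidiagonalSum s X (λ i r → iq r * iq i * weight (suc m) i))) ⟩
      kernel m s + X * kernel (suc m) s ∎
      where
      X = a * pow q (suc m) * pow q s
      first second : ℕ → ℕ → Carrier
      first i r = iq-pred r * iq i * weight m i
      second i r = pow q r * (iq r * iq-pred i) * weight m i
      pascal : ∀ i r → i ℕ.+ r ≡ suc s →
        (1# - pow q (suc s)) * (iq r * iq i * weight m i) ≈
        iq-pred r * iq i * weight m i + pow q r * (iq r * iq-pred i) * weight m i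
      pascal i r i+r≡1+s = begin
        (1# - pow q (suc s)) * (iq r * iq i * weight m i)
          ≈⟨ sym (*-assoc _ _ _) ⟩
        (1# - pow q (suc s)) * (iq r * iq i) * weight m i
          ≈⟨ *-congʳ (*-congʳ (reflexive (≡.cong (λ n → 1# - pow q n) (≡.sym i+r≡1+s)))) ⟩
        (1# - pow q (i ℕ.+ r)) * (iq r * iq i) * weight m i
          ≈⟨ *-congʳ (q-pascal i r) ⟩
        (iq-pred r * iq i + pow q r * (iq r * iq-pred i)) * weight m i
          ≈⟨ distribʳ _ _ _ ⟩
        iq-pred r * iq i * weight m i + pow q r * (iq r * iq-pred i) * weight m i ∎
      shift : ∀ i r → i ℕ.+ r ≡ s →
        pow q r * (iq r * iq i) * weight m (suc i) ≈ X * (iq r * iq i * weight (suc m) i)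
      shift i r i+r≡s = begin
        pow q r * (iq r * iq i) * weight m (suc i)    ≈⟨ xy∙z≈y∙xz _ _ _ ⟩
        iq r * iq i * (pow q r * weight m (suc i))    ≈⟨ *-congˡ (weight-shift m s i r i+r≡s) ⟩
        iq r * iq i * (X * weight (suc m) i)          ≈⟨ x∙yz≈y∙xz _ _ _ ⟩
        X * (iq r * iq i * weight (suc m) i)          ∎

    poch-kernel : ∀ s m → poch q q s * kernel m s ≈ iaq (m ℕ.+ s)
    poch-kernel zero m = begin
      1# * (iq 0 * iq 0 * (1# * 1# * iaq (m ℕ.+ 0)))  ≈⟨ *-congˡ (*-congʳ (*-cong iq-zero iq-zero)) ⟩
      1# * (1# * 1# * (1# * 1# * iaq (m ℕ.+ 0)))      ≈⟨ solve 1 (λ x → one :* (one :* one :* (one :* one :* x)) := x) refl _ ⟩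
      iaq (m ℕ.+ 0)                                     ∎
    poch-kernel (suc s) m = begin
      poch q q s * (1# - pow q (suc s)) * kernel m (suc s)   ≈⟨ *-assoc _ _ _ ⟩
      poch q q s * ((1# - pow q (suc s)) * kernel m (suc s)) ≈⟨ *-congˡ (kernel-step m s) ⟩
      poch q q s * (kernel m s + X * kernel (suc m) s)       ≈⟨ distribˡ _ _ _ ⟩
      poch q q s * kernel m s + poch q q s * (X * kernel (suc m) s)
        ≈⟨ +-cong (poch-kernel s m) (trans (x∙yz≈y∙xz _ _ _) (*-congˡ (poch-kernel s (suc m)))) ⟩
      iaq (m ℕ.+ s) + X * iaq (suc m ℕ.+ s)
        ≈⟨ +-congʳ (sym (iaq-suc (m ℕ.+ s))) ⟩
      iaq (suc (m ℕ.+ s)) * (1# - a * q * pow q (m ℕ.+ s)) + X * iaq (suc m ℕ.+ s)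
        ≈⟨ +-congʳ (*-congˡ (+-congˡ (-‿cong (*-congˡ (pow-+ q m s))))) ⟩
      iaq (suc m ℕ.+ s) * (1# - a * q * (pow q m * pow q s)) + a * (q * pow q m) * pow q s * iaq (suc m ℕ.+ s)
        ≈⟨ solve 5 (λ A a q Qm Qs → A :* (one :- a :* q :* (Qm :* Qs)) :+ a :* (q :* Qm) :* Qs :* A := A)
                   refl (iaq (suc m ℕ.+ s)) a q (pow q m) (pow q s) ⟩
      iaq (suc m ℕ.+ s)                                      ≈⟨ reflexive (≡.cong iaq (≡.sym (ℕ.+-suc m s))) ⟩
      iaq (m ℕ.+ suc s)                                      ∎
      where
      X = a * pow q (suc m) * pow q s

    kernel-closed : ∀ m s → kernel m s ≈ iq s * iaq (m ℕ.+ s)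
    kernel-closed m s = begin
      kernel m s                        ≈⟨ sym (*-identityˡ _) ⟩
      1# * kernel m s                   ≈⟨ *-congʳ (sym (trans (*-comm _ _) (iq-inverse s))) ⟩
      iq s * poch q q s * kernel m s    ≈⟨ *-assoc _ _ _ ⟩
      iq s * (poch q q s * kernel m s)  ≈⟨ *-congˡ (poch-kernel s m) ⟩
      iq s * iaq (m ℕ.+ s)              ∎

    module Shifted (iqq : Carrier) (q-inverse : IsInverse q iqq) where

      kernel⁻ : ℕ → ℕ → Carrier
      kernel⁻ m s = antidiagonalSum s (λ i r → iq r * iq i * (weight m i * pow iqq i))

      kernel-split : ∀ m s → kernel m (suc s) ≈ kernel m s + pow q (suc s) * kernel⁻ m (suc s)
      kernel-split m s = begin
        kernel m (suc s)
          ≈⟨ antidiagonalSum-cong (suc s) (λ i r _ →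
               trans (*-congʳ (*-congʳ (iq-split r)))
                     (trans (*-congʳ (distribʳ (iq i) (iq-pred r) (pow q r * iq r)))
                            (distribʳ (weight m i) (iq-pred r * iq i) (pow q r * iq r * iq i)))) ⟩
        antidiagonalSum (suc s) (λ i r → first i r + second i r)
          ≈⟨ antidiagonalSum-distrib-+ (suc s) first second ⟩
        antidiagonalSum (suc s) first + antidiagonalSum (suc s) second
          ≈⟨ +-cong (antidiagonalSum-dropLast s first (trans (*-congʳ (zeroˡ _)) (zeroˡ _)))
                    (antidiagonalSum-cong (suc s) second≈) ⟩
        kernel m s + antidiagonalSum (suc s) (λ i r → Q * (iq r * iq i * (weight m i * pow iqq i)))
          ≈⟨ +-congˡ (sym (*-distribˡ-antidiagonalSum (suc s) Q (λ i r → iq r * iq i * (weight m i * pow iqq i)))) ⟩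
        kernel m s + Q * kernel⁻ m (suc s) ∎
        where
        Q = pow q (suc s)
        first second : ℕ → ℕ → Carrier
        first i r = iq-pred r * iq i * weight m i
        second i r = pow q r * iq r * iq i * weight m i
        second≈ : ∀ i r → i ℕ.+ r ≡ suc s → second i r ≈ Q * (iq r * iq i * (weight m i * pow iqq i))
        second≈ i r i+r≡1+s = begin
          second i r                                 ≈⟨ sym (*-identityˡ _) ⟩
          1# * second i r                            ≈⟨ *-congʳ (sym (pow-inverse q-inverse i)) ⟩
          pow q i * pow iqq i * second i r
            ≈⟨ solve 6 (λ Qi Ei Qr x y w → Qi :* Ei :* (Qr :* x :* y :* w) := Qi :* Qr :* (x :* y :* (w :* Ei)))
                       refl (pow q i) (pow iqq i) (pow q r) (iq r) (iq i) (weight m i) ⟩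
          pow q i * pow q r * (iq r * iq i * (weight m i * pow iqq i))
            ≈⟨ *-congʳ (trans (sym (pow-+ q i r)) (reflexive (≡.cong (pow q) i+r≡1+s))) ⟩
          Q * (iq r * iq i * (weight m i * pow iqq i)) ∎

      kernel⁻-closed : ∀ m s → kernel⁻ m s ≈ iq s * iaq (m ℕ.+ s) * (1# + a * pow q m - a * pow q m * pow q s)
      kernel⁻-closed m zero = begin
        iq 0 * iq 0 * (1# * 1# * A * 1#)       ≈⟨ *-congʳ (*-cong iq-zero iq-zero) ⟩
        1# * 1# * (1# * 1# * A * 1#)           ≈⟨ solve 2 (λ A b → one :* one :* (one :* one :* A :* one) := one :* A :* (one :+ b :- b :* one))
                                                          refl A (a * pow q m) ⟩
        1# * A * (1# + a * pow q m - a * pow q m * 1#) ≈⟨ *-congʳ (*-congʳ (sym iq-zero)) ⟩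
        iq 0 * A * (1# + a * pow q m - a * pow q m * 1#) ∎
        where
        A = iaq (m ℕ.+ 0)
      kernel⁻-closed m (suc s) = invertible-*-cancelˡ (pow-inverse q-inverse (suc s)) (begin
        Q * kernel⁻ m (suc s)
          ≈⟨ solve 2 (λ x y → x := y :+ x :- y) refl _ (kernel m s) ⟩
        kernel m s + Q * kernel⁻ m (suc s) - kernel m s
          ≈⟨ +-cong (sym (kernel-split m s)) (-‿cong (kernel-closed m s)) ⟩
        kernel m (suc s) - iq s * iaq (m ℕ.+ s)
          ≈⟨ +-cong (kernel-closed m (suc s)) (-‿cong (*-cong (sym (iq-suc s)) iaq[m+s]≈)) ⟩
        iq (suc s) * A - iq (suc s) * (1# - Q) * (A * (1# - a * q * (pow q m * pow q s)))
          ≈⟨ solve 6 (λ e A q Qs a Qm →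
                        e :* A :- e :* (one :- q :* Qs) :* (A :* (one :- a :* q :* (Qm :* Qs))) :=
                        q :* Qs :* (e :* A :* (one :+ a :* Qm :- a :* Qm :* (q :* Qs))))
                     refl (iq (suc s)) A q (pow q s) a (pow q m) ⟩
        Q * (iq (suc s) * A * (1# + a * pow q m - a * pow q m * Q)) ∎)
        where
        Q = pow q (suc s)
        A = iaq (m ℕ.+ suc s)
        iaq[m+s]≈ : iaq (m ℕ.+ s) ≈ A * (1# - a * q * (pow q m * pow q s))
        iaq[m+s]≈ = begin
          iaq (m ℕ.+ s)                                              ≈⟨ sym (iaq-suc (m ℕ.+ s)) ⟩
          iaq (suc (m ℕ.+ s)) * (1# - a * q * pow q (m ℕ.+ s))       ≈⟨ *-cong (reflexive (≡.cong iaq (≡.sym (ℕ.+-suc m s))))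
                                                                               (+-congˡ (-‿cong (*-congˡ (pow-+ q m s)))) ⟩
          A * (1# - a * q * (pow q m * pow q s))                     ∎

  module BaileyLemma (a q ia : Carrier) (a-inverse : IsInverse a ia)
    (iqq : Carrier) (q-inverse : IsInverse q iqq)
    (iq : ℕ → Carrier) (iq-inverse : ∀ k → IsInverse (poch q q k) (iq k))
    (iaq : ℕ → Carrier) (iaq-inverse : ∀ k → IsInverse (poch (a * q) q k) (iaq k)) where
    open ChuVandermonde a q iq iq-inverse iaq iaq-inverse
    open Shifted iqq q-inverse
    open InversePochhammer iaq-inverse using () renaming (inverse-poch-suc to iaq-suc)

    -- the coefficient of α_j in β_{j+s}
    baileyCoefficient : ℕ → ℕ → Carrier
    baileyCoefficient j s = iq s * iaq (j ℕ.+ s ℕ.+ j)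

    prefactor : ℕ → Carrier
    prefactor n = pow a n * pow q (n ℕ.* n ∸ n)

    ownPart : ℕ → ℕ → Carrier
    ownPart j s = prefactor j * (1# + pow q (2 ℕ.* j)) * baileyCoefficient j s

    partialSumCoefficient : ℕ → ℕ → Carrier
    partialSumCoefficient j s =
      prefactor j * ((1# - a * pow q (2 ℕ.* j)) * (1# - ia)) * baileyCoefficient j s

    partialSumsPart : ℕ → ℕ → Carrier
    partialSumsPart j s =
      (1# - ia) * a * (pow a j * pow q (j ℕ.* j)) * (pow q j * (1# - pow q s)) * baileyCoefficient j s

    partialSumsPart-zero : ∀ j → partialSumsPart j 0 ≈ 0#
    partialSumsPart-zero j =
      solve 4 (λ x y Qj M → x :* y :* (Qj :* (one :- one)) :* M := con (+ 0))
            refl ((1# - ia) * a) (pow a j * pow q (j ℕ.* j)) (pow q j) (baileyCoefficient j 0)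

    partialSumsPart-step : ∀ l s →
      partialSumCoefficient (suc l) s + partialSumsPart (suc l) s ≈ partialSumsPart l (suc s)
    partialSumsPart-step l s = begin
      partialSumCoefficient (suc l) s + partialSumsPart (suc l) s
        ≈⟨ +-cong (*-cong (*-cong (*-congˡ (pow-square∸-suc q l))
                                  (*-congʳ (+-congˡ (-‿cong (*-congˡ (pow-double q (suc l)))))))
                          coefficient≈)
                  (*-cong (*-congʳ (*-congˡ (*-congˡ (pow-square-suc q l)))) coefficient≈) ⟩
      a * al * (Ql * Qll) * ((1# - a * (q * Ql * (q * Ql))) * (1# - ia)) * (e * (1# - q * Qs) * A)
        + (1# - ia) * a * (a * al * (q * (Ql * (Ql * Qll)))) * (q * Ql * (1# - Qs)) * (e * (1# - q * Qs) * A)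
        ≈⟨ solve 9 (λ a al Ql Qll q Qs ia e A →
             a :* al :* (Ql :* Qll) :* ((one :- a :* (q :* Ql :* (q :* Ql))) :* (one :- ia)) :* (e :* (one :- q :* Qs) :* A)
               :+ (one :- ia) :* a :* (a :* al :* (q :* (Ql :* (Ql :* Qll)))) :* (q :* Ql :* (one :- Qs))
                    :* (e :* (one :- q :* Qs) :* A) :=
             (one :- ia) :* a :* (al :* Qll) :* (Ql :* (one :- q :* Qs)) :* (e :* (A :* (one :- a :* q :* (Ql :* (q :* Qs) :* Ql)))))
                   refl a al Ql Qll q Qs ia e A ⟩
      (1# - ia) * a * (al * Qll) * (Ql * (1# - q * Qs)) * (e * (A * (1# - a * q * (Ql * (q * Qs) * Ql))))
        ≈⟨ *-congˡ (*-congˡ (sym iaq≈)) ⟩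
      partialSumsPart l (suc s) ∎
      where
      al = pow a l
      Ql = pow q l
      Qll = pow q (l ℕ.* l)
      Qs = pow q s
      e = iq (suc s)
      A = iaq (suc (l ℕ.+ suc s ℕ.+ l))
      index : ∀ l s → suc l ℕ.+ s ℕ.+ suc l ≡ suc (l ℕ.+ suc s ℕ.+ l)
      index = solve-∀
      coefficient≈ : baileyCoefficient (suc l) s ≈ e * (1# - q * Qs) * A
      coefficient≈ = *-cong (sym (iq-suc s)) (reflexive (≡.cong iaq (index l s)))
      iaq≈ : iaq (l ℕ.+ suc s ℕ.+ l) ≈ A * (1# - a * q * (Ql * (q * Qs) * Ql))
      iaq≈ = trans (sym (iaq-suc _))
                   (*-congˡ (+-congˡ (-‿cong (*-congˡ (trans (pow-+ q (l ℕ.+ suc s) l) (*-congʳ (pow-+ q l (suc s))))))))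

    partialSums-telescope : ∀ u l →
      antidiagonalSum u (λ t r → partialSumCoefficient (suc (l ℕ.+ t)) r) ≈ partialSumsPart l (suc u)
    partialSums-telescope zero l = begin
      partialSumCoefficient (suc (l ℕ.+ 0)) 0
        ≈⟨ reflexive (≡.cong (λ k → partialSumCoefficient (suc k) 0) (ℕ.+-identityʳ l)) ⟩
      partialSumCoefficient (suc l) 0
        ≈⟨ sym (trans (+-congˡ (partialSumsPart-zero (suc l))) (+-identityʳ _)) ⟩
      partialSumCoefficient (suc l) 0 + partialSumsPart (suc l) 0
        ≈⟨ partialSumsPart-step l 0 ⟩
      partialSumsPart l 1 ∎
    partialSums-telescope (suc u) l = begin
      partialSumCoefficient (suc (l ℕ.+ 0)) (suc u) +
        antidiagonalSum u (λ t r → partialSumCoefficient (suc (l ℕ.+ suc t)) r)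
        ≈⟨ +-cong (reflexive (≡.cong (λ k → partialSumCoefficient (suc k) (suc u)) (ℕ.+-identityʳ l)))
                  (antidiagonalSum-cong u (λ t r _ →
                     reflexive (≡.cong (λ k → partialSumCoefficient k r) (≡.cong suc (ℕ.+-suc l t))))) ⟩
      partialSumCoefficient (suc l) (suc u) +
        antidiagonalSum u (λ t r → partialSumCoefficient (suc (suc l ℕ.+ t)) r)
        ≈⟨ +-congˡ (partialSums-telescope u (suc l)) ⟩
      partialSumCoefficient (suc l) (suc u) + partialSumsPart (suc l) (suc u)
        ≈⟨ partialSumsPart-step l (suc u) ⟩
      partialSumsPart l (suc (suc u)) ∎

    module _ (α : ℕ → Carrier) where

      partialSums-interchange : ∀ n →
        antidiagonalSum n (λ j s → partialSumCoefficient j s * sumTo j α) ≈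
        antidiagonalSum n (λ j s → α j * partialSumsPart j s)
      partialSums-interchange zero = trans (zeroʳ _) (sym (trans (*-congˡ (partialSumsPart-zero 0)) (zeroʳ _)))
      partialSums-interchange (suc n) = begin
        antidiagonalSum (suc n) (λ j s → partialSumCoefficient j s * sumTo j α)
          ≈⟨ antidiagonalSum-dropFirst n (λ j s → partialSumCoefficient j s * sumTo j α) (zeroʳ _) ⟩
        antidiagonalSum n (λ m r → partialSumCoefficient (suc m) r * sumTo (suc m) α)
          ≈⟨ antidiagonalSum-cong n (λ m r _ → *-congˡ (sumTo-antidiagonalSum m (λ _ l → α l))) ⟩
        antidiagonalSum n (λ m r → partialSumCoefficient (suc m) r * antidiagonalSum m (λ l t → α l))
          ≈⟨ antidiagonalSum-cong n (λ m r _ →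
               trans (*-distribˡ-antidiagonalSum m _ (λ l t → α l))
                     (antidiagonalSum-cong m (λ l t l+t≡m →
                        reflexive (≡.cong (λ k → partialSumCoefficient (suc k) r * α l) (≡.sym l+t≡m))))) ⟩
        antidiagonalSum n (λ m r → antidiagonalSum m (λ l t → partialSumCoefficient (suc (l ℕ.+ t)) r * α l))
          ≈⟨ antidiagonalSum-assoc n (λ l t r → partialSumCoefficient (suc (l ℕ.+ t)) r * α l) ⟩
        antidiagonalSum n (λ l u → antidiagonalSum u (λ t r → partialSumCoefficient (suc (l ℕ.+ t)) r * α l))
          ≈⟨ antidiagonalSum-cong n (λ l u _ → begin
               antidiagonalSum u (λ t r → partialSumCoefficient (suc (l ℕ.+ t)) r * α l)
                 ≈⟨ antidiagonalSum-cong u (λ t r _ → *-comm _ _) ⟩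
               antidiagonalSum u (λ t r → α l * partialSumCoefficient (suc (l ℕ.+ t)) r)
                 ≈⟨ sym (*-distribˡ-antidiagonalSum u (α l) (λ t r → partialSumCoefficient (suc (l ℕ.+ t)) r)) ⟩
               α l * antidiagonalSum u (λ t r → partialSumCoefficient (suc (l ℕ.+ t)) r)
                 ≈⟨ *-congˡ (partialSums-telescope u l) ⟩
               α l * partialSumsPart l (suc u) ∎) ⟩
        antidiagonalSum n (λ l u → α l * partialSumsPart l (suc u))
          ≈⟨ sym (antidiagonalSum-dropLast n (λ j s → α j * partialSumsPart j s)
                                             (trans (*-congˡ (partialSumsPart-zero (suc n))) (zeroʳ _))) ⟩
        antidiagonalSum (suc n) (λ j s → α j * partialSumsPart j s) ∎

      alpha'-summand : ∀ j s →
        alpha' a q ia α j * baileyCoefficient j s ≈ α j * ownPart j s + partialSumCoefficient j s * sumTo j α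
      alpha'-summand j s =
        solve 7 (λ P Q2 x a ia S M →
                   P :* ((one :+ Q2) :* x :+ (one :- a :* Q2) :* (one :- ia) :* S) :* M :=
                   x :* (P :* (one :+ Q2) :* M) :+ P :* ((one :- a :* Q2) :* (one :- ia)) :* M :* S)
                refl (prefactor j) (pow q (2 ℕ.* j)) (α j) a ia (sumTo j α) (baileyCoefficient j s)

      alpha'-expansion : ∀ n →
        sumTo (suc n) (λ l → alpha' a q ia α l * (iq (n ∸ l) * iaq (n ℕ.+ l))) ≈
        antidiagonalSum n (λ j s → α j * (ownPart j s + partialSumsPart j s))
      alpha'-expansion n = begin
        sumTo (suc n) (λ l → alpha' a q ia α l * (iq (n ∸ l) * iaq (n ℕ.+ l)))
          ≈⟨ sumTo-antidiagonalSum n (λ n l → alpha' a q ia α l * (iq (n ∸ l) * iaq (n ℕ.+ l))) ⟩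
        antidiagonalSum n (λ j s → alpha' a q ia α j * (iq (j ℕ.+ s ∸ j) * iaq (j ℕ.+ s ℕ.+ j)))
          ≈⟨ antidiagonalSum-cong n (λ j s _ →
               trans (*-congˡ (*-congʳ (reflexive (≡.cong iq (ℕ.m+n∸m≡n j s))))) (alpha'-summand j s)) ⟩
        antidiagonalSum n (λ j s → α j * ownPart j s + partialSumCoefficient j s * sumTo j α)
          ≈⟨ antidiagonalSum-distrib-+ n _ _ ⟩
        antidiagonalSum n (λ j s → α j * ownPart j s) +
          antidiagonalSum n (λ j s → partialSumCoefficient j s * sumTo j α)
          ≈⟨ +-congˡ (partialSums-interchange n) ⟩
        antidiagonalSum n (λ j s → α j * ownPart j s) + antidiagonalSum n (λ j s → α j * partialSumsPart j s)
          ≈⟨ sym (antidiagonalSum-distrib-+ n _ _) ⟩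
        antidiagonalSum n (λ j s → α j * ownPart j s + α j * partialSumsPart j s)
          ≈⟨ antidiagonalSum-cong n (λ j s _ → sym (distribˡ _ _ _)) ⟩
        antidiagonalSum n (λ j s → α j * (ownPart j s + partialSumsPart j s)) ∎

    beta'-summand : ℕ → ℕ → Carrier
    beta'-summand l r = pow a l * pow q (l ℕ.* l) * iq r * (pow q (l ℕ.+ r) + pow iqq l)

    innerSum : ℕ → ℕ → Carrier
    innerSum j s = antidiagonalSum s (λ i r → beta'-summand (j ℕ.+ i) r * baileyCoefficient j i)

    innerSum-summand : ∀ j s i r → i ℕ.+ r ≡ s →
      beta'-summand (j ℕ.+ i) r * baileyCoefficient j i ≈
      pow a j * pow q (j ℕ.* j) * pow q (j ℕ.+ s) * (iq r * iq i * weight (j ℕ.+ j) i) +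
      pow a j * pow q (j ℕ.* j) * pow iqq j * (iq r * iq i * (weight (j ℕ.+ j) i * pow iqq i))
    innerSum-summand j s i r i+r≡s = begin
      beta'-summand (j ℕ.+ i) r * baileyCoefficient j i
        ≈⟨ *-cong (*-cong (*-congʳ (*-cong (pow-+ a j i) square≈)) (+-cong Qj+i+r≈ (pow-+ iqq j i)))
                  (*-congˡ (reflexive (≡.cong iaq (index j i)))) ⟩
      aj * ai * (Qjj * (Q2ji * Qii)) * iq r * (pow q (j ℕ.+ s) + Ej * Ei) * (iq i * A)
        ≈⟨ solve 11 (λ aj ai Qjj Q2ji Qii er Qjs Ej Ei ei A →
             aj :* ai :* (Qjj :* (Q2ji :* Qii)) :* er :* (Qjs :+ Ej :* Ei) :* (ei :* A) :=
             aj :* Qjj :* Qjs :* (er :* ei :* (ai :* Q2ji :* Qii :* A)) :+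
             aj :* Qjj :* Ej :* (er :* ei :* (ai :* Q2ji :* Qii :* A :* Ei)))
                   refl aj ai Qjj Q2ji Qii (iq r) (pow q (j ℕ.+ s)) Ej Ei (iq i) A ⟩
      aj * Qjj * pow q (j ℕ.+ s) * (iq r * iq i * (ai * Q2ji * Qii * A)) +
      aj * Qjj * Ej * (iq r * iq i * (ai * Q2ji * Qii * A * Ei))
        ≈⟨ sym (+-cong (*-congˡ (*-congˡ weight≈)) (*-congˡ (*-congˡ (*-congʳ weight≈)))) ⟩
      pow a j * pow q (j ℕ.* j) * pow q (j ℕ.+ s) * (iq r * iq i * weight (j ℕ.+ j) i) +
      pow a j * pow q (j ℕ.* j) * pow iqq j * (iq r * iq i * (weight (j ℕ.+ j) i * pow iqq i)) ∎
      where
      aj = pow a j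
      ai = pow a i
      Qjj = pow q (j ℕ.* j)
      Q2ji = pow q ((j ℕ.+ j) ℕ.* i)
      Qii = pow q (i ℕ.* i)
      Ej = pow iqq j
      Ei = pow iqq i
      A = iaq (j ℕ.+ j ℕ.+ i)
      square : ∀ j i → (j ℕ.+ i) ℕ.* (j ℕ.+ i) ≡ j ℕ.* j ℕ.+ ((j ℕ.+ j) ℕ.* i ℕ.+ i ℕ.* i)
      square = solve-∀
      index : ∀ j i → j ℕ.+ i ℕ.+ j ≡ j ℕ.+ j ℕ.+ i
      index = solve-∀
      square≈ : pow q ((j ℕ.+ i) ℕ.* (j ℕ.+ i)) ≈ Qjj * (Q2ji * Qii)
      square≈ = trans (reflexive (≡.cong (pow q) (square j i)))
                      (trans (pow-+ q (j ℕ.* j) _) (*-congˡ (pow-+ q ((j ℕ.+ j) ℕ.* i) (i ℕ.* i))))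
      Qj+i+r≈ : pow q (j ℕ.+ i ℕ.+ r) ≈ pow q (j ℕ.+ s)
      Qj+i+r≈ = reflexive (≡.cong (pow q) (≡.trans (ℕ.+-assoc j i r) (≡.cong (j ℕ.+_) i+r≡s)))
      weight≈ : weight (j ℕ.+ j) i ≈ ai * Q2ji * Qii * A
      weight≈ = *-congʳ (*-congʳ (trans (pow-* a (pow q (j ℕ.+ j)) i) (*-congˡ (pow-pow q (j ℕ.+ j) i))))

    innerSum-kernels : ∀ j s → innerSum j s ≈
      pow a j * pow q (j ℕ.* j) * pow q (j ℕ.+ s) * kernel (j ℕ.+ j) s +
      pow a j * pow q (j ℕ.* j) * pow iqq j * kernel⁻ (j ℕ.+ j) s
    innerSum-kernels j s = begin
      innerSum j s
        ≈⟨ antidiagonalSum-cong s (innerSum-summand j s) ⟩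
      antidiagonalSum s (λ i r → X * (iq r * iq i * weight (j ℕ.+ j) i) +
                                 Y * (iq r * iq i * (weight (j ℕ.+ j) i * pow iqq i)))
        ≈⟨ antidiagonalSum-distrib-+ s _ _ ⟩
      antidiagonalSum s (λ i r → X * (iq r * iq i * weight (j ℕ.+ j) i)) +
      antidiagonalSum s (λ i r → Y * (iq r * iq i * (weight (j ℕ.+ j) i * pow iqq i)))
        ≈⟨ sym (+-cong (*-distribˡ-antidiagonalSum s X (λ i r → iq r * iq i * weight (j ℕ.+ j) i))
                       (*-distribˡ-antidiagonalSum s Y (λ i r → iq r * iq i * (weight (j ℕ.+ j) i * pow iqq i)))) ⟩
      X * kernel (j ℕ.+ j) s + Y * kernel⁻ (j ℕ.+ j) s ∎
      where
      X = pow a j * pow q (j ℕ.* j) * pow q (j ℕ.+ s)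
      Y = pow a j * pow q (j ℕ.* j) * pow iqq j

    -- The two sides differ by multiples of q^j q^{-j} - 1 and a a⁻¹ - 1.
    kernel-combination : ∀ aj Qjm Qj Ej Qs M → Qj * Ej ≈ 1# →
      aj * (Qjm * Qj) * (Qj * Qs) * M + aj * (Qjm * Qj) * Ej * (M * (1# + a * (Qj * Qj) - a * (Qj * Qj) * Qs)) ≈
      aj * Qjm * (1# + Qj * Qj) * M + (1# - ia) * a * (aj * (Qjm * Qj)) * (Qj * (1# - Qs)) * M
    kernel-combination aj Qjm Qj Ej Qs M QjEj≈1 = begin
      aj * (Qjm * Qj) * (Qj * Qs) * M + aj * (Qjm * Qj) * Ej * (M * (1# + a * (Qj * Qj) - a * (Qj * Qj) * Qs))
        ≈⟨ solve 8 (λ aj Qjm Qj Ej Qs M a ia →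
             aj :* (Qjm :* Qj) :* (Qj :* Qs) :* M :+ aj :* (Qjm :* Qj) :* Ej :* (M :* (one :+ a :* (Qj :* Qj) :- a :* (Qj :* Qj) :* Qs)) :=
             aj :* Qjm :* (one :+ Qj :* Qj) :* M :+ (one :- ia) :* a :* (aj :* (Qjm :* Qj)) :* (Qj :* (one :- Qs)) :* M
               :+ (Qj :* Ej :- one) :* (aj :* Qjm :* M :* (one :+ a :* (Qj :* Qj) :- a :* (Qj :* Qj) :* Qs))
               :+ (a :* ia :- one) :* (aj :* Qjm :* M :* (Qj :* Qj) :* (one :- Qs)))
                   refl aj Qjm Qj Ej Qs M a ia ⟩
      rhs + (Qj * Ej - 1#) * V + (a * ia - 1#) * W  ≈⟨ x≈1⇒y+[x-1]z≈y _ W a-inverse ⟩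
      rhs + (Qj * Ej - 1#) * V                      ≈⟨ x≈1⇒y+[x-1]z≈y rhs V QjEj≈1 ⟩
      rhs                                           ∎
      where
      rhs = aj * Qjm * (1# + Qj * Qj) * M + (1# - ia) * a * (aj * (Qjm * Qj)) * (Qj * (1# - Qs)) * M
      V = aj * Qjm * M * (1# + a * (Qj * Qj) - a * (Qj * Qj) * Qs)
      W = aj * Qjm * M * (Qj * Qj) * (1# - Qs)

    innerSum-closed : ∀ j s → innerSum j s ≈ ownPart j s + partialSumsPart j s
    innerSum-closed j s = begin
      innerSum j s
        ≈⟨ innerSum-kernels j s ⟩
      aj * Qjj * pow q (j ℕ.+ s) * kernel (j ℕ.+ j) s + aj * Qjj * Ej * kernel⁻ (j ℕ.+ j) s
        ≈⟨ +-cong (*-congˡ (kernel-closed (j ℕ.+ j) s)) (*-congˡ (kernel⁻-closed (j ℕ.+ j) s)) ⟩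
      aj * Qjj * pow q (j ℕ.+ s) * (iq s * iaq (j ℕ.+ j ℕ.+ s)) +
      aj * Qjj * Ej * (iq s * iaq (j ℕ.+ j ℕ.+ s) * (1# + a * pow q (j ℕ.+ j) - a * pow q (j ℕ.+ j) * Qs))
        ≈⟨ +-cong (*-cong (*-cong (*-congˡ Qjj≈) (pow-+ q j s)) M≈)
                  (*-cong (*-congʳ (*-congˡ Qjj≈))
                          (*-cong M≈ (+-cong (+-congˡ (*-congˡ (pow-+ q j j))) (-‿cong (*-congʳ (*-congˡ (pow-+ q j j))))))) ⟩
      aj * (Qjm * Qj) * (Qj * Qs) * M + aj * (Qjm * Qj) * Ej * (M * (1# + a * (Qj * Qj) - a * (Qj * Qj) * Qs))
        ≈⟨ kernel-combination aj Qjm Qj Ej Qs M (pow-inverse q-inverse j) ⟩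
      aj * Qjm * (1# + Qj * Qj) * M + (1# - ia) * a * (aj * (Qjm * Qj)) * (Qj * (1# - Qs)) * M
        ≈⟨ sym (+-cong (*-congʳ (*-congˡ (+-congˡ (pow-double q j))))
                       (*-congʳ (*-congʳ (*-congˡ (*-congˡ Qjj≈))))) ⟩
      ownPart j s + partialSumsPart j s ∎
      where
      aj = pow a j
      Qj = pow q j
      Qjj = pow q (j ℕ.* j)
      Qjm = pow q (j ℕ.* j ∸ j)
      Ej = pow iqq j
      Qs = pow q s
      M = baileyCoefficient j s
      index : ∀ j s → j ℕ.+ j ℕ.+ s ≡ j ℕ.+ s ℕ.+ j
      index = solve-∀
      Qjj≈ : Qjj ≈ Qjm * Qj
      Qjj≈ = pow-square-split q j
      M≈ : iq s * iaq (j ℕ.+ j ℕ.+ s) ≈ M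
      M≈ = *-congˡ (reflexive (≡.cong iaq (index j s)))

    module _ (α β : ℕ → Carrier) (pair : BaileyPair iq iaq α β) where

      beta-expansion : ∀ l → β l ≈ antidiagonalSum l (λ j i → α j * baileyCoefficient j i)
      beta-expansion l =
        trans (pair l)
              (trans (sumTo-antidiagonalSum l (λ n j → α j * (iq (n ∸ j) * iaq (n ℕ.+ j))))
                     (antidiagonalSum-cong l (λ j i _ → *-congˡ (*-congʳ (reflexive (≡.cong iq (ℕ.m+n∸m≡n j i)))))))

      beta'-expansion : ∀ n → beta' a q iqq iq β n ≈ antidiagonalSum n (λ j s → α j * innerSum j s)
      beta'-expansion n = begin
        beta' a q iqq iq β n
          ≈⟨ sumTo-antidiagonalSum n (λ n l → pow a l * pow q (l ℕ.* l) * iq (n ∸ l) * (pow q n + pow iqq l) * β l) ⟩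
        antidiagonalSum n (λ l r → pow a l * pow q (l ℕ.* l) * iq (l ℕ.+ r ∸ l) * (pow q (l ℕ.+ r) + pow iqq l) * β l)
          ≈⟨ antidiagonalSum-cong n (λ l r _ →
               *-cong (*-congʳ (*-congˡ (reflexive (≡.cong iq (ℕ.m+n∸m≡n l r))))) (beta-expansion l)) ⟩
        antidiagonalSum n (λ l r → beta'-summand l r * antidiagonalSum l (λ j i → α j * baileyCoefficient j i))
          ≈⟨ antidiagonalSum-cong n (λ l r _ →
               trans (*-distribˡ-antidiagonalSum l (beta'-summand l r) (λ j i → α j * baileyCoefficient j i))
                     (antidiagonalSum-cong l (λ j i j+i≡l →
                        reflexive (≡.cong (λ k → beta'-summand k r * (α j * baileyCoefficient j i)) (≡.sym j+i≡l))))) ⟩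
        antidiagonalSum n (λ l r → antidiagonalSum l (λ j i → summand j i r))
          ≈⟨ antidiagonalSum-assoc n summand ⟩
        antidiagonalSum n (λ j s → antidiagonalSum s (λ i r → summand j i r))
          ≈⟨ antidiagonalSum-cong n (λ j s _ →
               trans (antidiagonalSum-cong s (λ i r _ → x∙yz≈y∙xz _ _ _))
                     (sym (*-distribˡ-antidiagonalSum s (α j) (λ i r → beta'-summand (j ℕ.+ i) r * baileyCoefficient j i)))) ⟩
        antidiagonalSum n (λ j s → α j * innerSum j s) ∎
        where
        summand : ℕ → ℕ → ℕ → Carrier
        summand j i r = beta'-summand (j ℕ.+ i) r * (α j * baileyCoefficient j i)

      alpha'-beta'-pair : BaileyPair iq iaq (alpha' a q ia α) (beta' a q iqq iq β)
      alpha'-beta'-pair n = begin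
        beta' a q iqq iq β n                                                  ≈⟨ beta'-expansion n ⟩
        antidiagonalSum n (λ j s → α j * innerSum j s)                        ≈⟨ antidiagonalSum-cong n (λ j s _ → *-congˡ (innerSum-closed j s)) ⟩
        antidiagonalSum n (λ j s → α j * (ownPart j s + partialSumsPart j s)) ≈⟨ sym (alpha'-expansion α n) ⟩
        sumTo (suc n) (λ l → alpha' a q ia α l * (iq (n ∸ l) * iaq (n ℕ.+ l))) ∎

lemma3p1 : ∀ {c ℓ} (R : CommutativeRing c ℓ) →
    let open CommutativeRing R in
    let open QSeries R in
    (a q : Carrier) →
    (ia : Carrier) → IsInverse a ia →
    (iqq : Carrier) → IsInverse q iqq →
    (iq : ℕ → Carrier) → (∀ k → IsInverse (poch q q k) (iq k)) →
    (iaq : ℕ → Carrier) → (∀ k → IsInverse (poch (a * q) q k) (iaq k)) →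
    (α β : ℕ → Carrier) →
    BaileyPair iq iaq α β →
    BaileyPair iq iaq (alpha' a q ia α) (beta' a q iqq iq β)
lemma3p1 R a q ia a-inverse iqq q-inverse iq iq-inverse iaq iaq-inverse =
  QSeriesIdentities.BaileyLemma.alpha'-beta'-pair R a q ia a-inverse iqq q-inverse iq iq-inverse iaq iaq-inverse
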